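{- Let $r,s\ge 1$, let $m_1,\ldots,m_r$ and $n_1,\ldots,n_s$ be non-negative integers with $m_{r+1}=m_1$, $n_{s+1}=n_1$, and let $0\leq a\leq s$ and $1\leq b\leq r$ be integers. Then \[ F_{r,s}^{(b)}(\mathbf m;\mathbf n;a;q^{ -1})=q^{ -\Delta(\mathbf m;\mathbf n)}F_{r,s}^{(r-b+1)}(\mathbf m;\mathbf n;s-a;q). \] Moreover, if $F_{r,s}^{(r-b+1)}(\mathbf m;\mathbf n;s-a;q)$ is a polynomial in $q$, then its degree is at most $\Delta(\mathbf m;\mathbf n)$.
   Context: For a non-negative integer $n$, $[n]=\frac{1-q^n}{1-q}$, $[n]!=[1][2]\cdots[n]$, $[0]!=1$. For integers $N,K$, $\begin{bmatrix} N\\ K\end{bmatrix}=\frac{[N]!}{[K]![N-K]!}$ if $0\le K\le N$ and $0$ otherwise. For every integer $x$, $\binom{x}{2}=x(x-1)/2$. For $\mathbf m=(m_1,\ldots,m_r)$, $\mathbf n=(n_1,\ldots,n_s)$ (indices cyclic: $m_{r+1}=m_1$, $n_{s+1}=n_1$), $1\le b\le r$ and $0\le a\le s$, \[ F_{r,s}^{(b)}(\mathbf m;\mathbf n;a;q)=\frac{[m_1]!\,[n_1]!\,[m_r+n_s+1]!}{[m_1+m_r+1]!\,[n_1+n_s]!}\sum_{k=-n_1}^{n_1}(-1)^k q^{a k^2+(2b-1)\binom{k}{2}}\prod_{i=1}^{r}\begin{bmatrix} m_i+m_{i+1}+1\\ m_i+k\end{bmatrix}\prod_{j=1}^{s}\begin{bmatrix}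 n_j+n_{j+1}\\ n_j+k\end{bmatrix}, \] a rational function of $q$, and $F(\ldots;q^{ -1})$ denotes substitution of $q^{ -1}$ for $q$. Further \[ \Delta(\mathbf m;\mathbf n)=\binom{m_1}{2}+\binom{n_1}{2}+\binom{m_r+n_s+1}{2}-\binom{m_1+m_r+1}{2}-\binom{n_1+n_s}{2}+\sum_{i=1}^{r}m_i(m_{i+1}+1)+\sum_{j=1}^{s}n_jn_{j+1}. \] -}

module Defs where

open import Data.Nat as ℕ using (ℕ; zero; suc; NonZero; _<?_; s≤s)
open import Data.Integer as ℤ using (ℤ; +_; -[1+_])
open import Data.Integer.DivMod using () renaming (_/_ to _divℤ_)
open import Data.Fin using (Fin; zero; suc; toℕ; fromℕ; fromℕ<)
open import Data.Product using (_×_)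
open import Data.List using (List; []; _∷_)
open import Data.Rational as ℚ using (ℚ; 0ℚ; 1ℚ; _+_; _*_; _-_; -_; ≢-nonZero; _÷_; 1/_)
open import Data.Rational.Properties using (_≟_)
open import Relation.Nullary using (yes; no)
open import Relation.Binary.PropositionalEquality using (_≡_; _≢_)

-- total division: x ⊘ y = x / y when y ≠ 0, and 0 otherwise
-- (only ever used at points where the denominator is nonzero)
_⊘_ : ℚ → ℚ → ℚ
x ⊘ y with y ≟ 0ℚ
... | yes _ = 0ℚ
... | no y≢0 = _÷_ x y {{≢-nonZero y≢0}}

infixl 7 _⊘_

_^ℕ_ : ℚ → ℕ → ℚ
q ^ℕ zero = 1ℚ
q ^ℕ suc n = q * (q ^ℕ n)

_^ℤ_ : ℚ → ℤ → ℚ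
q ^ℤ (+ n) = q ^ℕ n
q ^ℤ (-[1+ n ]) = 1ℚ ⊘ (q ^ℕ suc n)

qinv : ℚ → ℚ
qinv q = 1ℚ ⊘ q

qnum : ℚ → ℕ → ℚ
qnum q zero = 0ℚ
qnum q (suc n) = (q ^ℕ n) + qnum q n

qfact : ℚ → ℕ → ℚ
qfact q zero = 1ℚ
qfact q (suc n) = qnum q (suc n) * qfact q n

qbinom : ℚ → ℤ → ℤ → ℚ
qbinom q N K with K ℤ.<? + 0 | N ℤ.<? K
... | yes _ | _ = 0ℚ
... | no _ | yes _ = 0ℚ
... | no _ | no _ =
  qfact q ℤ.∣ N ∣ ⊘ (qfact q ℤ.∣ K ∣ * qfact q ℤ.∣ N ℤ.- K ∣)

choose2 : ℤ → ℤ
choose2 x = (x ℤ.* (x ℤ.- + 1)) divℤ (+ 2)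

prodFin : ∀ {n} → (Fin n → ℚ) → ℚ
prodFin {zero} f = 1ℚ
prodFin {suc n} f = f zero * prodFin (λ i → f (suc i))

sumFrom : ℤ → ℕ → (ℤ → ℚ) → ℚ
sumFrom lo zero f = 0ℚ
sumFrom lo (suc len) f = f lo + sumFrom (ℤ.suc lo) len f

sumSym : ℕ → (ℤ → ℚ) → ℚ
sumSym n f = sumFrom (ℤ.- (+ n)) (suc (n ℕ.+ n)) f

-- cyclic indexing on Fin r (r ≥ 1): index 1 ↦ zero, index r ↦ fromℕ

first : ∀ r → .{{NonZero r}} → Fin r
first (suc r) = zero

lastI : ∀ r → .{{NonZero r}} → Fin r
lastI (suc r) = fromℕ r

next : ∀ {r} → Fin r → Fin r
next {suc r} i with suc (toℕ i) <? suc r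
... | yes p = fromℕ< p
... | no _ = zero

-- The function F^{(b)}_{r,s}(m; n; a; q), evaluated at a rational q.
-- m : Fin r → ℕ encodes (m_1,…,m_r) (m_1 = m (first r), m_r = m (lastI r)),
-- similarly n : Fin s → ℕ.

F : (r s : ℕ) → .{{NonZero r}} → .{{NonZero s}} →
    (b : ℕ) → (m : Fin r → ℕ) → (n : Fin s → ℕ) → (a : ℕ) → ℚ → ℚ
F r s b m n a q =
  (qfact q m₁ * qfact q n₁ * qfact q (mr ℕ.+ ns ℕ.+ 1))
    ⊘ (qfact q (m₁ ℕ.+ mr ℕ.+ 1) * qfact q (n₁ ℕ.+ ns))
  * sumSym n₁ term
  where
    m₁ = m (first r)
    mr = m (lastI r)
    n₁ = n (first s)
    ns = n (lastI s)
    sign : ℤ → ℚ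
    sign k = (- 1ℚ) ^ℤ k
    term : ℤ → ℚ
    term k =
      sign k
      * (q ^ℤ ((+ a) ℤ.* (k ℤ.* k) ℤ.+ ((+ 2) ℤ.* (+ b) ℤ.- + 1) ℤ.* choose2 k))
      * prodFin (λ i → qbinom q (+ (m i ℕ.+ m (next i) ℕ.+ 1)) (+ m i ℤ.+ k))
      * prodFin (λ j → qbinom q (+ (n j ℕ.+ n (next j))) (+ n j ℤ.+ k))

sumFinℤ : ∀ {n} → (Fin n → ℤ) → ℤ
sumFinℤ {zero} f = + 0
sumFinℤ {suc n} f = f zero ℤ.+ sumFinℤ (λ i → f (suc i))

Δ : (r s : ℕ) → .{{NonZero r}} → .{{NonZero s}} →
    (m : Fin r → ℕ) → (n : Fin s → ℕ) → ℤ
Δ r s m n =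
  choose2 (+ m₁) ℤ.+ choose2 (+ n₁) ℤ.+ choose2 (+ (mr ℕ.+ ns ℕ.+ 1))
  ℤ.- choose2 (+ (m₁ ℕ.+ mr ℕ.+ 1)) ℤ.- choose2 (+ (n₁ ℕ.+ ns))
  ℤ.+ sumFinℤ (λ i → + (m i ℕ.* (m (next i) ℕ.+ 1)))
  ℤ.+ sumFinℤ (λ j → + (n j ℕ.* n (next j)))
  where
    m₁ = m (first r)
    mr = m (lastI r)
    n₁ = n (first s)
    ns = n (lastI s)

-- polynomials with rational coefficients, as coefficient lists c₀, c₁, …

evalPoly : List ℚ → ℚ → ℚ
evalPoly [] q = 0ℚ
evalPoly (c ∷ cs) q = c + q * evalPoly cs q

coeff : List ℚ → ℕ → ℚ
coeff [] i = 0ℚ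
coeff (c ∷ cs) zero = c
coeff (c ∷ cs) (suc i) = coeff cs i

-- "admissible" evaluation points: q ∉ {0, 1, -1}; at all such rational q
-- every q-factorial is nonzero, and a rational-function identity holds iff
-- it holds at all these (infinitely many) points.
Admissible : ℚ → Set
Admissible q = (q ≢ 0ℚ) × (q ≢ 1ℚ) × (q ≢ - 1ℚ)

{-# OPTIONS --safe #-}

-- Under q ↦ q⁻¹ the q-factorial [n]! becomes q^(-C(n,2)) [n]!, so the q-binomial [N; K] becomes
-- q^(-K(N-K)) [N; K].  In the k-th summand of F the two cyclic products of binomials therefore pick
-- up q^(-Σ mᵢ(mᵢ₊₁+1) - Σ nⱼnⱼ₊₁) · q^(r(k²-k) + s k²): the parts linear in k telescope around the
-- cycles.  Since r(k²-k) = 2r C(k,2), this extra power turns the weight q^(-(a k² + (2b-1) C(k,2)))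
-- into q^((s-a) k² + (2(r-b+1)-1) C(k,2)), the weight of the dual summand, and together with the
-- prefactor the total factor is q^(-Δ).
--
-- For the degree bound, the symmetry reads F′(q) = q^Δ F(q⁻¹).  When b ≥ 1 every power of x in F
-- has a nonnegative exponent and every q-factorial lies in [1, n!] for x ∈ [0,1], so F is bounded
-- on [0,1].  Hence a polynomial agreeing with F′ is O(q^Δ) as q → ∞, and its coefficients above Δ
-- vanish.

module Submission where

open import Defs

open import Algebra.Bundles using (CommutativeMonoid)
open import Data.Empty using (⊥-elim)
open import Data.Fin using (Fin; zero; suc; toℕ; fromℕ; inject₁)
import Data.Fin.Properties as FinP
open import Data.Integer as ℤ using (ℤ; +_; -[1+_]; _⊖_)
open import Data.Integer.DivMod using (div-pos-is-/ℕ) renaming (_/_ to _divℤ_)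
import Data.Integer.Properties as ℤP
import Data.Integer.Tactic.RingSolver as ℤ-Solver
open import Data.List using (List; []; _∷_; _++_; replicate)
open import Data.Nat as ℕ using (ℕ; zero; suc)
open import Data.Nat.Combinatorics using (_C_; nC1≡n; nCk+nC[k+1]≡[n+1]C[k+1])
open import Data.Nat.DivMod using (m*n/n≡m)
import Data.Nat.Properties as ℕP
import Data.Nat.Tactic.RingSolver as ℕ-Solver
open import Data.Product using (Σ; _×_; _,_; proj₁; proj₂)
open import Data.Rational as ℚ using (ℚ; 0ℚ; 1ℚ; _+_; _*_; _-_; -_; ∣_∣; _≤_; _<_)
import Data.Rational.Properties as ℚP
open import Data.Sum using (inj₁; inj₂)
open import Level using (0ℓ)
open import Relation.Binary.PropositionalEquality
open import Relation.Nullary using (yes; no; ¬_)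
open import Relation.Nullary.Decidable using (toSum; dec⇒maybe)
open import Tactic.RingSolver using (solve-∀)
import Tactic.RingSolver.Core.AlmostCommutativeRing as ACR

open import Algebra.Apartness.Properties.HeytingCommutativeRing ℚP.heytingCommutativeRing using (x#0y#0→xy#0)
open import Algebra.Properties.CommutativeSemigroup ℤP.+-commutativeSemigroup using () renaming (interchange to +-interchange)
open import Algebra.Properties.CommutativeSemigroup (CommutativeMonoid.commutativeSemigroup ℚP.*-1-commutativeMonoid) using (x∙yz≈y∙xz) renaming (interchange to *-interchange)

-- The zero test lets the solver cancel opposite coefficients.
ℚ-ring : ACR.AlmostCommutativeRing 0ℓ 0ℓ
ℚ-ring = ACR.fromCommutativeRing ℚP.+-*-commutativeRing (λ x → dec⇒maybe (0ℚ ℚP.≟ x))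

⊘≡*qinv : ∀ x y → x ⊘ y ≡ x * qinv y
⊘≡*qinv x y with y ℚP.≟ 0ℚ
... | yes _ = sym (ℚP.*-zeroʳ x)
... | no _  = cong (x *_) (sym (ℚP.*-identityˡ _))

qinv-inverseˡ : ∀ {y} → y ≢ 0ℚ → qinv y * y ≡ 1ℚ
qinv-inverseˡ {y} y≢0 with y ℚP.≟ 0ℚ
... | yes y≡0 = ⊥-elim (y≢0 y≡0)
... | no y≢0′ = trans (cong (_* y) (ℚP.*-identityˡ (ℚ.1/ y))) (ℚP.*-inverseˡ y)
  where instance _ = ℚ.≢-nonZero y≢0′

qinv-inverseʳ : ∀ {y} → y ≢ 0ℚ → y * qinv y ≡ 1ℚ
qinv-inverseʳ {y} y≢0 = trans (ℚP.*-comm y (qinv y)) (qinv-inverseˡ y≢0)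

qinv-unique : ∀ {x y} → x * y ≡ 1ℚ → qinv y ≡ x
qinv-unique {x} {y} xy≡1 = begin
  qinv y            ≡⟨ sym (ℚP.*-identityˡ _) ⟩
  1ℚ * qinv y       ≡⟨ cong (_* qinv y) (sym xy≡1) ⟩
  x * y * qinv y    ≡⟨ ℚP.*-assoc x y (qinv y) ⟩
  x * (y * qinv y)  ≡⟨ cong (x *_) (qinv-inverseʳ y≢0) ⟩
  x * 1ℚ            ≡⟨ ℚP.*-identityʳ x ⟩
  x                 ∎
  where
  open ≡-Reasoning
  y≢0 : y ≢ 0ℚ
  y≢0 refl = ℚP.1≢0 (trans (sym xy≡1) (ℚP.*-zeroʳ x))

qinv-involutive : ∀ x → qinv (qinv x) ≡ x
qinv-involutive x with toSum (x ℚP.≟ 0ℚ)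
... | inj₁ refl = refl
... | inj₂ x≢0 = qinv-unique (qinv-inverseʳ x≢0)

qinv-distrib-* : ∀ x y → qinv (x * y) ≡ qinv x * qinv y
qinv-distrib-* x y with toSum (x ℚP.≟ 0ℚ) | toSum (y ℚP.≟ 0ℚ)
... | inj₁ refl | _ = trans (cong qinv (ℚP.*-zeroˡ y)) (sym (ℚP.*-zeroˡ (qinv y)))
... | inj₂ _ | inj₁ refl = trans (cong qinv (ℚP.*-zeroʳ x)) (sym (ℚP.*-zeroʳ (qinv x)))
... | inj₂ x≢0 | inj₂ y≢0 = qinv-unique (begin
  qinv x * qinv y * (x * y)    ≡⟨ *-interchange (qinv x) (qinv y) x y ⟩
  qinv x * x * (qinv y * y)    ≡⟨ cong₂ _*_ (qinv-inverseˡ x≢0) (qinv-inverseˡ y≢0) ⟩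
  1ℚ                           ∎)
  where open ≡-Reasoning

^ℕ-homo-+ : ∀ x m n → x ^ℕ (m ℕ.+ n) ≡ x ^ℕ m * x ^ℕ n
^ℕ-homo-+ x zero    n = sym (ℚP.*-identityˡ _)
^ℕ-homo-+ x (suc m) n = trans (cong (x *_) (^ℕ-homo-+ x m n)) (sym (ℚP.*-assoc x _ _))

^ℕ-≢0 : ∀ {x} n → x ≢ 0ℚ → x ^ℕ n ≢ 0ℚ
^ℕ-≢0 zero    x≢0 = ℚP.1≢0
^ℕ-≢0 (suc n) x≢0 = x#0y#0→xy#0 x≢0 (^ℕ-≢0 n x≢0)

qinv-^ℕ : ∀ x n → qinv x ^ℕ n ≡ qinv (x ^ℕ n)
qinv-^ℕ x zero    = refl
qinv-^ℕ x (suc n) = trans (cong (qinv x *_) (qinv-^ℕ x n)) (sym (qinv-distrib-* x (x ^ℕ n)))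

^ℤ-⊖ : ∀ {x} → x ≢ 0ℚ → ∀ m n → x ^ℤ (m ⊖ n) ≡ x ^ℕ m * qinv (x ^ℕ n)
^ℤ-⊖ x≢0 m       zero    = sym (ℚP.*-identityʳ _)
^ℤ-⊖ {x} x≢0 zero (suc n) = ⊘≡*qinv 1ℚ (x ^ℕ suc n)
^ℤ-⊖ {x} x≢0 (suc m) (suc n) = begin
  x ^ℤ (suc m ⊖ suc n)                       ≡⟨ cong (x ^ℤ_) (ℤP.[1+m]⊖[1+n]≡m⊖n m n) ⟩
  x ^ℤ (m ⊖ n)                               ≡⟨ ^ℤ-⊖ x≢0 m n ⟩
  x ^ℕ m * qinv (x ^ℕ n)                     ≡⟨ sym (ℚP.*-identityˡ _) ⟩
  1ℚ * (x ^ℕ m * qinv (x ^ℕ n))              ≡⟨ cong (_* (x ^ℕ m * qinv (x ^ℕ n))) (sym (qinv-inverseʳ x≢0)) ⟩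
  x * qinv x * (x ^ℕ m * qinv (x ^ℕ n))      ≡⟨ *-interchange x (qinv x) (x ^ℕ m) (qinv (x ^ℕ n)) ⟩
  x * x ^ℕ m * (qinv x * qinv (x ^ℕ n))      ≡⟨ cong (x * x ^ℕ m *_) (sym (qinv-distrib-* x (x ^ℕ n))) ⟩
  x * x ^ℕ m * qinv (x * x ^ℕ n)             ∎
  where open ≡-Reasoning

^ℤ-homo-+ : ∀ {x} → x ≢ 0ℚ → ∀ z w → x ^ℤ (z ℤ.+ w) ≡ x ^ℤ z * x ^ℤ w
^ℤ-homo-+ {x} x≢0 (+ m)    (+ n)    = ^ℕ-homo-+ x m n
^ℤ-homo-+ {x} x≢0 (+ m)    -[1+ n ] = ^ℤ-⊖ x≢0 m (suc n)
^ℤ-homo-+ {x} x≢0 -[1+ m ] (+ n)    = trans (^ℤ-⊖ x≢0 n (suc m)) (ℚP.*-comm (x ^ℕ n) (qinv (x ^ℕ suc m)))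
^ℤ-homo-+ {x} x≢0 -[1+ m ] -[1+ n ] = begin
  qinv (x ^ℕ suc (suc (m ℕ.+ n)))       ≡⟨ cong (λ e → qinv (x ^ℕ suc e)) (sym (ℕP.+-suc m n)) ⟩
  qinv (x ^ℕ (suc m ℕ.+ suc n))         ≡⟨ cong qinv (^ℕ-homo-+ x (suc m) (suc n)) ⟩
  qinv (x ^ℕ suc m * x ^ℕ suc n)        ≡⟨ qinv-distrib-* (x ^ℕ suc m) (x ^ℕ suc n) ⟩
  qinv (x ^ℕ suc m) * qinv (x ^ℕ suc n) ∎
  where open ≡-Reasoning

^ℤ-neg : ∀ x z → x ^ℤ (ℤ.- z) ≡ qinv (x ^ℤ z)
^ℤ-neg x (+ zero)  = refl
^ℤ-neg x (+ suc n) = refl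
^ℤ-neg x -[1+ n ]  = sym (qinv-involutive (x ^ℕ suc n))

qinv-^ℤ : ∀ x z → qinv x ^ℤ z ≡ x ^ℤ (ℤ.- z)
qinv-^ℤ x (+ n)    = trans (qinv-^ℕ x n) (sym (^ℤ-neg x (+ n)))
qinv-^ℤ x -[1+ n ] = trans (cong qinv (qinv-^ℕ x (suc n))) (qinv-involutive (x ^ℕ suc n))

sumFrom-cong : ∀ lo len {f g : ℤ → ℚ} → (∀ k → f k ≡ g k) → sumFrom lo len f ≡ sumFrom lo len g
sumFrom-cong lo zero      f≗g = refl
sumFrom-cong lo (suc len) f≗g = cong₂ _+_ (f≗g lo) (sumFrom-cong (ℤ.suc lo) len f≗g)

sumFrom-*ˡ : ∀ lo len c (f : ℤ → ℚ) → sumFrom lo len (λ k → c * f k) ≡ c * sumFrom lo len f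
sumFrom-*ˡ lo zero      c f = sym (ℚP.*-zeroʳ c)
sumFrom-*ˡ lo (suc len) c f =
  trans (cong (λ t → c * f lo + t) (sumFrom-*ˡ (ℤ.suc lo) len c f)) (sym (ℚP.*-distribˡ-+ c (f lo) _))

sumFinℤ-cong : ∀ {n} {f g : Fin n → ℤ} → (∀ i → f i ≡ g i) → sumFinℤ f ≡ sumFinℤ g
sumFinℤ-cong {zero}  f≗g = refl
sumFinℤ-cong {suc n} f≗g = cong₂ ℤ._+_ (f≗g zero) (sumFinℤ-cong (λ i → f≗g (suc i)))

sumFinℤ-+ : ∀ {n} (f g : Fin n → ℤ) → sumFinℤ (λ i → f i ℤ.+ g i) ≡ sumFinℤ f ℤ.+ sumFinℤ g
sumFinℤ-+ {zero}  f g = refl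
sumFinℤ-+ {suc n} f g = trans (cong (λ t → f zero ℤ.+ g zero ℤ.+ t) (sumFinℤ-+ (λ i → f (suc i)) (λ i → g (suc i))))
                              (+-interchange (f zero) (g zero) (sumFinℤ (λ i → f (suc i))) (sumFinℤ (λ i → g (suc i))))

sumFinℤ-*ˡ : ∀ {n} c (f : Fin n → ℤ) → sumFinℤ (λ i → c ℤ.* f i) ≡ c ℤ.* sumFinℤ f
sumFinℤ-*ˡ {zero}  c f = sym (ℤP.*-zeroʳ c)
sumFinℤ-*ˡ {suc n} c f = trans (cong (λ t → c ℤ.* f zero ℤ.+ t) (sumFinℤ-*ˡ c (λ i → f (suc i))))
                               (sym (ℤP.*-distribˡ-+ c (f zero) (sumFinℤ (λ i → f (suc i)))))

sumFinℤ-neg : ∀ {n} (f : Fin n → ℤ) → sumFinℤ (λ i → ℤ.- f i) ≡ ℤ.- sumFinℤ f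
sumFinℤ-neg {zero}  f = refl
sumFinℤ-neg {suc n} f = trans (cong (λ t → ℤ.- f zero ℤ.+ t) (sumFinℤ-neg (λ i → f (suc i))))
                              (sym (ℤP.neg-distrib-+ (f zero) (sumFinℤ (λ i → f (suc i)))))

sumFinℤ-const : ∀ n c → sumFinℤ {n} (λ _ → c) ≡ + n ℤ.* c
sumFinℤ-const zero    c = sym (ℤP.*-zeroˡ c)
sumFinℤ-const (suc n) c = trans (cong (λ t → c ℤ.+ t) (sumFinℤ-const n c)) (sym (ℤP.suc-* (+ n) c))

sumFinℤ-init-last : ∀ {n} (f : Fin (suc n) → ℤ) → sumFinℤ f ≡ sumFinℤ (λ i → f (inject₁ i)) ℤ.+ f (fromℕ n)
sumFinℤ-init-last {zero}  f = trans (ℤP.+-identityʳ (f zero)) (sym (ℤP.+-identityˡ (f zero)))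
sumFinℤ-init-last {suc n} f = trans (cong (λ t → f zero ℤ.+ t) (sumFinℤ-init-last (λ i → f (suc i))))
                                    (sym (ℤP.+-assoc (f zero) _ _))

next-inject₁ : ∀ {n} (i : Fin n) → next (inject₁ i) ≡ suc i
next-inject₁ {suc n} i with suc (toℕ (inject₁ i)) ℕ.<? suc (suc n)
... | yes p = FinP.toℕ-injective (trans (FinP.toℕ-fromℕ< p) (cong suc (FinP.toℕ-inject₁ i)))
... | no ¬p = ⊥-elim (¬p (ℕ.s≤s (subst (ℕ._< suc n) (sym (FinP.toℕ-inject₁ i)) (FinP.toℕ<n i))))

next-fromℕ : ∀ n → next (fromℕ n) ≡ zero
next-fromℕ n with suc (toℕ (fromℕ n)) ℕ.<? suc n
... | yes p = ⊥-elim (ℕP.<-irrefl refl (subst (λ t → suc t ℕ.< suc n) (FinP.toℕ-fromℕ n) p))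
... | no _  = refl

sumFinℤ-rotate : ∀ {n} (f : Fin n → ℤ) → sumFinℤ (λ i → f (next i)) ≡ sumFinℤ f
sumFinℤ-rotate {zero}  f = refl
sumFinℤ-rotate {suc n} f = begin
  sumFinℤ (λ i → f (next i))                                    ≡⟨ sumFinℤ-init-last (λ i → f (next i)) ⟩
  sumFinℤ (λ i → f (next (inject₁ i))) ℤ.+ f (next (fromℕ n))  ≡⟨ cong₂ ℤ._+_ (sumFinℤ-cong (λ i → cong f (next-inject₁ i)))
                                                                               (cong f (next-fromℕ n)) ⟩
  sumFinℤ (λ i → f (suc i)) ℤ.+ f zero                          ≡⟨ ℤP.+-comm _ (f zero) ⟩
  sumFinℤ f                                                     ∎
  where open ≡-Reasoning

sumFinℤ-telescope : ∀ {n} (x : Fin n → ℤ) → sumFinℤ (λ i → x i ℤ.- x (next i)) ≡ + 0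
sumFinℤ-telescope x = begin
  sumFinℤ (λ i → x i ℤ.- x (next i))                    ≡⟨ sumFinℤ-+ x (λ i → ℤ.- x (next i)) ⟩
  sumFinℤ x ℤ.+ sumFinℤ (λ i → ℤ.- x (next i))          ≡⟨ cong (λ t → sumFinℤ x ℤ.+ t) (sumFinℤ-neg (λ i → x (next i))) ⟩
  sumFinℤ x ℤ.- sumFinℤ (λ i → x (next i))              ≡⟨ cong (λ t → sumFinℤ x ℤ.- t) (sumFinℤ-rotate x) ⟩
  sumFinℤ x ℤ.- sumFinℤ x                               ≡⟨ ℤP.+-inverseʳ (sumFinℤ x) ⟩
  + 0                                                   ∎
  where open ≡-Reasoning

cyclic-binomial-exponent : ∀ {n} (x w : Fin n → ℤ) c k → (∀ i → w i ≡ x i ℤ.+ x (next i) ℤ.+ c) →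
  sumFinℤ (λ i → ℤ.- ((x i ℤ.+ k) ℤ.* (w i ℤ.- (x i ℤ.+ k))))
    ≡ ℤ.- sumFinℤ (λ i → x i ℤ.* (x (next i) ℤ.+ c)) ℤ.+ + n ℤ.* (k ℤ.* k ℤ.- c ℤ.* k)
cyclic-binomial-exponent {n} x w c k w≡ = begin
  sumFinℤ (λ i → ℤ.- ((x i ℤ.+ k) ℤ.* (w i ℤ.- (x i ℤ.+ k))))
    ≡⟨ sumFinℤ-cong (λ i → trans (cong (λ t → ℤ.- ((x i ℤ.+ k) ℤ.* (t ℤ.- (x i ℤ.+ k)))) (w≡ i))
                                  (expand (x i) (x (next i)) c k)) ⟩
  sumFinℤ (λ i → ℤ.- A i ℤ.+ (d ℤ.+ k ℤ.* (x i ℤ.- x (next i))))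
    ≡⟨ sumFinℤ-+ (λ i → ℤ.- A i) (λ i → d ℤ.+ k ℤ.* (x i ℤ.- x (next i))) ⟩
  sumFinℤ (λ i → ℤ.- A i) ℤ.+ sumFinℤ (λ i → d ℤ.+ k ℤ.* (x i ℤ.- x (next i)))
    ≡⟨ cong₂ ℤ._+_ (sumFinℤ-neg A) (sumFinℤ-+ (λ _ → d) (λ i → k ℤ.* (x i ℤ.- x (next i)))) ⟩
  ℤ.- sumFinℤ A ℤ.+ (sumFinℤ {n} (λ _ → d) ℤ.+ sumFinℤ (λ i → k ℤ.* (x i ℤ.- x (next i))))
    ≡⟨ cong (λ t → ℤ.- sumFinℤ A ℤ.+ (sumFinℤ {n} (λ _ → d) ℤ.+ t))
            (trans (sumFinℤ-*ˡ k (λ i → x i ℤ.- x (next i))) (cong (k ℤ.*_) (sumFinℤ-telescope x))) ⟩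
  ℤ.- sumFinℤ A ℤ.+ (sumFinℤ {n} (λ _ → d) ℤ.+ k ℤ.* + 0)
    ≡⟨ cong₂ (λ u v → ℤ.- sumFinℤ A ℤ.+ (u ℤ.+ v)) (sumFinℤ-const n d) (ℤP.*-zeroʳ k) ⟩
  ℤ.- sumFinℤ A ℤ.+ (+ n ℤ.* d ℤ.+ + 0)
    ≡⟨ cong (λ t → ℤ.- sumFinℤ A ℤ.+ t) (ℤP.+-identityʳ (+ n ℤ.* d)) ⟩
  ℤ.- sumFinℤ A ℤ.+ + n ℤ.* d
    ∎
  where
  open ≡-Reasoning
  A : Fin n → ℤ
  A i = x i ℤ.* (x (next i) ℤ.+ c)
  d = k ℤ.* k ℤ.- c ℤ.* k
  expand : ∀ x y c k → ℤ.- ((x ℤ.+ k) ℤ.* (x ℤ.+ y ℤ.+ c ℤ.- (x ℤ.+ k)))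
                       ≡ ℤ.- (x ℤ.* (y ℤ.+ c)) ℤ.+ (k ℤ.* k ℤ.- c ℤ.* k ℤ.+ k ℤ.* (x ℤ.- y))
  expand = ℤ-Solver.solve-∀

-- Rescaling by powers of q

module Rescaling {q : ℚ} (q≢0 : q ≢ 0ℚ) where

  -- A record rather than a bare equation, so that e and y can be recovered by unification.
  infix 4 _≃q^_·_
  record _≃q^_·_ (x : ℚ) (e : ℤ) (y : ℚ) : Set where
    constructor rescaled
    field equation : x ≡ q ^ℤ e * y
  open _≃q^_·_ public

  rescale-exponent : ∀ {x y e f} → e ≡ f → x ≃q^ e · y → x ≃q^ f · y
  rescale-exponent refl x≃y = x≃y

  rescale-* : ∀ {x x′ y y′ e f} → x ≃q^ e · x′ → y ≃q^ f · y′ → x * y ≃q^ e ℤ.+ f · x′ * y′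
  rescale-* {x′ = x′} {y′ = y′} {e} {f} (rescaled refl) (rescaled refl) = rescaled (begin
    q ^ℤ e * x′ * (q ^ℤ f * y′)  ≡⟨ *-interchange (q ^ℤ e) x′ (q ^ℤ f) y′ ⟩
    q ^ℤ e * q ^ℤ f * (x′ * y′)  ≡⟨ cong (_* (x′ * y′)) (sym (^ℤ-homo-+ q≢0 e f)) ⟩
    q ^ℤ (e ℤ.+ f) * (x′ * y′)   ∎)
    where open ≡-Reasoning

  rescale-*ˡ : ∀ {x y y′ f} → y ≃q^ f · y′ → x * y ≃q^ f · x * y′
  rescale-*ˡ {x} {y′ = y′} {f} (rescaled refl) = rescaled (x∙yz≈y∙xz x (q ^ℤ f) y′)

  rescale-*ʳ : ∀ {x x′ y e} → x ≃q^ e · x′ → x * y ≃q^ e · x′ * y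
  rescale-*ʳ {x′ = x′} {y} {e} (rescaled refl) = rescaled (ℚP.*-assoc (q ^ℤ e) x′ y)

  rescale-⊘ : ∀ {x x′ y y′ e f} → x ≃q^ e · x′ → y ≃q^ f · y′ → x ⊘ y ≃q^ e ℤ.- f · x′ ⊘ y′
  rescale-⊘ {x′ = x′} {y′ = y′} {e} {f} (rescaled refl) (rescaled refl) = rescaled (begin
    (q ^ℤ e * x′) ⊘ (q ^ℤ f * y′)             ≡⟨ ⊘≡*qinv (q ^ℤ e * x′) (q ^ℤ f * y′) ⟩
    q ^ℤ e * x′ * qinv (q ^ℤ f * y′)          ≡⟨ cong (q ^ℤ e * x′ *_) (qinv-distrib-* (q ^ℤ f) y′) ⟩
    q ^ℤ e * x′ * (qinv (q ^ℤ f) * qinv y′)   ≡⟨ *-interchange (q ^ℤ e) x′ (qinv (q ^ℤ f)) (qinv y′) ⟩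
    q ^ℤ e * qinv (q ^ℤ f) * (x′ * qinv y′)   ≡⟨ cong₂ (λ u v → q ^ℤ e * u * v) (sym (^ℤ-neg q f)) (sym (⊘≡*qinv x′ y′)) ⟩
    q ^ℤ e * q ^ℤ (ℤ.- f) * (x′ ⊘ y′)         ≡⟨ cong (_* (x′ ⊘ y′)) (sym (^ℤ-homo-+ q≢0 e (ℤ.- f))) ⟩
    q ^ℤ (e ℤ.- f) * (x′ ⊘ y′)                ∎)
    where open ≡-Reasoning

  rescale-prodFin : ∀ {n} {f g : Fin n → ℚ} {e : Fin n → ℤ} → (∀ i → f i ≃q^ e i · g i) →
                    prodFin f ≃q^ sumFinℤ e · prodFin g
  rescale-prodFin {zero}  f≃g = rescaled refl
  rescale-prodFin {suc n} f≃g = rescale-* (f≃g zero) (rescale-prodFin (λ i → f≃g (suc i)))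

  rescale-sumFrom : ∀ lo len {f g : ℤ → ℚ} {e} → (∀ k → f k ≃q^ e · g k) →
                    sumFrom lo len f ≃q^ e · sumFrom lo len g
  rescale-sumFrom lo len {f} {g} {e} f≃g = rescaled (begin
    sumFrom lo len f                            ≡⟨ sumFrom-cong lo len (λ k → equation (f≃g k)) ⟩
    sumFrom lo len (λ k → q ^ℤ e * g k)         ≡⟨ sumFrom-*ˡ lo len (q ^ℤ e) g ⟩
    q ^ℤ e * sumFrom lo len g                   ∎)
    where open ≡-Reasoning

  power-rescaled : ∀ e → q ^ℤ e ≃q^ e · 1ℚ
  power-rescaled e = rescaled (sym (ℚP.*-identityʳ (q ^ℤ e)))

  qinv-power-rescaled : ∀ e → qinv q ^ℤ e ≃q^ ℤ.- e · 1ℚ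
  qinv-power-rescaled e = rescaled (trans (qinv-^ℤ q e) (sym (ℚP.*-identityʳ (q ^ℤ (ℤ.- e)))))

  rescale-common : ∀ {x y z e f} d → x ≃q^ e · z → y ≃q^ f · z → e ≡ d ℤ.+ f → x ≃q^ d · y
  rescale-common {z = z} {f = f} d (rescaled refl) (rescaled refl) refl = rescaled (begin
    q ^ℤ (d ℤ.+ f) * z       ≡⟨ cong (_* z) (^ℤ-homo-+ q≢0 d f) ⟩
    q ^ℤ d * q ^ℤ f * z      ≡⟨ ℚP.*-assoc (q ^ℤ d) (q ^ℤ f) z ⟩
    q ^ℤ d * (q ^ℤ f * z)    ∎)
    where open ≡-Reasoning

  unscale : ∀ {x y} e → q ^ℤ e * x ≡ y → x ≃q^ ℤ.- e · y
  unscale {x} e refl = rescaled (begin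
    x                              ≡⟨ sym (ℚP.*-identityˡ x) ⟩
    1ℚ * x                         ≡⟨ cong (λ d → q ^ℤ d * x) (sym (ℤP.+-inverseˡ e)) ⟩
    q ^ℤ (ℤ.- e ℤ.+ e) * x         ≡⟨ cong (_* x) (^ℤ-homo-+ q≢0 (ℤ.- e) e) ⟩
    q ^ℤ (ℤ.- e) * q ^ℤ e * x      ≡⟨ ℚP.*-assoc (q ^ℤ (ℤ.- e)) (q ^ℤ e) x ⟩
    q ^ℤ (ℤ.- e) * (q ^ℤ e * x)    ∎)
    where open ≡-Reasoning

[1+n]C2≡n+nC2 : ∀ n → suc n C 2 ≡ n ℕ.+ n C 2
[1+n]C2≡n+nC2 n = trans (sym (nCk+nC[k+1]≡[n+1]C[k+1] n 1)) (cong (ℕ._+ n C 2) (nC1≡n n))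

[m+n]C2≡mC2+nC2+m*n : ∀ m n → (m ℕ.+ n) C 2 ≡ m C 2 ℕ.+ n C 2 ℕ.+ m ℕ.* n
[m+n]C2≡mC2+nC2+m*n zero    n = sym (ℕP.+-identityʳ (n C 2))
[m+n]C2≡mC2+nC2+m*n (suc m) n = begin
  suc (m ℕ.+ n) C 2                                ≡⟨ [1+n]C2≡n+nC2 (m ℕ.+ n) ⟩
  m ℕ.+ n ℕ.+ (m ℕ.+ n) C 2                        ≡⟨ cong (m ℕ.+ n ℕ.+_) ([m+n]C2≡mC2+nC2+m*n m n) ⟩
  m ℕ.+ n ℕ.+ (m C 2 ℕ.+ n C 2 ℕ.+ m ℕ.* n)        ≡⟨ regroup m n (m C 2) (n C 2) ⟩
  m ℕ.+ m C 2 ℕ.+ n C 2 ℕ.+ (n ℕ.+ m ℕ.* n)        ≡⟨ cong (λ t → t ℕ.+ n C 2 ℕ.+ suc m ℕ.* n) (sym ([1+n]C2≡n+nC2 m)) ⟩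
  suc m C 2 ℕ.+ n C 2 ℕ.+ suc m ℕ.* n              ∎
  where
  open ≡-Reasoning
  regroup : ∀ m n x y → m ℕ.+ n ℕ.+ (x ℕ.+ y ℕ.+ m ℕ.* n) ≡ m ℕ.+ x ℕ.+ y ℕ.+ (n ℕ.+ m ℕ.* n)
  regroup = ℕ-Solver.solve-∀

nC2*2+n≡n*n : ∀ n → (n C 2) ℕ.* 2 ℕ.+ n ≡ n ℕ.* n
nC2*2+n≡n*n zero    = refl
nC2*2+n≡n*n (suc n) = begin
  (suc n C 2) ℕ.* 2 ℕ.+ suc n            ≡⟨ cong (λ t → t ℕ.* 2 ℕ.+ suc n) ([1+n]C2≡n+nC2 n) ⟩
  (n ℕ.+ n C 2) ℕ.* 2 ℕ.+ suc n        ≡⟨ regroup n (n C 2) ⟩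
  (n C 2) ℕ.* 2 ℕ.+ n ℕ.+ suc (n ℕ.+ n)  ≡⟨ cong (ℕ._+ suc (n ℕ.+ n)) (nC2*2+n≡n*n n) ⟩
  n ℕ.* n ℕ.+ suc (n ℕ.+ n)            ≡⟨ square n ⟩
  suc n ℕ.* suc n                      ∎
  where
  open ≡-Reasoning
  regroup : ∀ n c → (n ℕ.+ c) ℕ.* 2 ℕ.+ suc n ≡ c ℕ.* 2 ℕ.+ n ℕ.+ suc (n ℕ.+ n)
  regroup = ℕ-Solver.solve-∀
  square : ∀ n → n ℕ.* n ℕ.+ suc (n ℕ.+ n) ≡ suc n ℕ.* suc n
  square = ℕ-Solver.solve-∀

n*[n-1]≡nC2*2 : ∀ n → + n ℤ.* (+ n ℤ.- + 1) ≡ + ((n C 2) ℕ.* 2)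
n*[n-1]≡nC2*2 n = begin
  + n ℤ.* (+ n ℤ.- + 1)                    ≡⟨ expand (+ n) ⟩
  + n ℤ.* + n ℤ.- + n                      ≡⟨ cong (ℤ._- + n) (sym (ℤP.pos-* n n)) ⟩
  + (n ℕ.* n) ℤ.- + n                      ≡⟨ cong (λ t → + t ℤ.- + n) (sym (nC2*2+n≡n*n n)) ⟩
  + ((n C 2) ℕ.* 2 ℕ.+ n) ℤ.- + n          ≡⟨ cong (ℤ._- + n) (ℤP.pos-+ ((n C 2) ℕ.* 2) n) ⟩
  + ((n C 2) ℕ.* 2) ℤ.+ + n ℤ.- + n        ≡⟨ cancel (+ ((n C 2) ℕ.* 2)) (+ n) ⟩
  + ((n C 2) ℕ.* 2)                        ∎
  where
  open ≡-Reasoning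
  expand : ∀ x → x ℤ.* (x ℤ.- + 1) ≡ x ℤ.* x ℤ.- x
  expand = ℤ-Solver.solve-∀
  cancel : ∀ t x → t ℤ.+ x ℤ.- x ≡ t
  cancel = ℤ-Solver.solve-∀

choose2-pos : ∀ n → choose2 (+ n) ≡ + (n C 2)
choose2-pos n = begin
  (+ n ℤ.* (+ n ℤ.- + 1)) divℤ + 2     ≡⟨ cong (_divℤ + 2) (n*[n-1]≡nC2*2 n) ⟩
  + ((n C 2) ℕ.* 2) divℤ + 2           ≡⟨ div-pos-is-/ℕ (+ ((n C 2) ℕ.* 2)) 2 ⟩
  + ((n C 2) ℕ.* 2 ℕ./ 2)              ≡⟨ cong +_ (m*n/n≡m (n C 2) 2) ⟩
  + (n C 2)                            ∎
  where open ≡-Reasoning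

x[x-1]-reflection : ∀ k → ℤ.- k ℤ.* (ℤ.- k ℤ.- + 1) ≡ (+ 1 ℤ.+ k) ℤ.* ((+ 1 ℤ.+ k) ℤ.- + 1)
x[x-1]-reflection = ℤ-Solver.solve-∀

choose2-neg : ∀ n → choose2 -[1+ n ] ≡ choose2 (+ suc (suc n))
choose2-neg n = cong (_divℤ + 2) (x[x-1]-reflection (+ suc n))

choose2*2≡k*[k-1] : ∀ k → choose2 k ℤ.* + 2 ≡ k ℤ.* (k ℤ.- + 1)
choose2*2≡k*[k-1] (+ n) = begin
  choose2 (+ n) ℤ.* + 2     ≡⟨ cong (ℤ._* + 2) (choose2-pos n) ⟩
  + (n C 2) ℤ.* + 2         ≡⟨ sym (ℤP.pos-* (n C 2) 2) ⟩
  + ((n C 2) ℕ.* 2)         ≡⟨ sym (n*[n-1]≡nC2*2 n) ⟩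
  + n ℤ.* (+ n ℤ.- + 1)     ∎
  where open ≡-Reasoning
choose2*2≡k*[k-1] -[1+ n ] = begin
  choose2 -[1+ n ] ℤ.* + 2                          ≡⟨ cong (ℤ._* + 2) (choose2-neg n) ⟩
  choose2 (+ suc (suc n)) ℤ.* + 2                   ≡⟨ choose2*2≡k*[k-1] (+ suc (suc n)) ⟩
  + suc (suc n) ℤ.* (+ suc (suc n) ℤ.- + 1)         ≡⟨ sym (x[x-1]-reflection (+ suc n)) ⟩
  -[1+ n ] ℤ.* (-[1+ n ] ℤ.- + 1)                   ∎
  where open ≡-Reasoning

choose2≡+∣choose2∣ : ∀ k → choose2 k ≡ + ℤ.∣ choose2 k ∣
choose2≡+∣choose2∣ (+ n)    rewrite choose2-pos n   = refl
choose2≡+∣choose2∣ -[1+ n ] rewrite choose2-neg n | choose2-pos (suc (suc n)) = refl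

-- q-analogues under q ↦ q⁻¹

qnum-horner : ∀ x n → qnum x (suc n) ≡ 1ℚ + x * qnum x n
qnum-horner x zero    = cong (λ t → 1ℚ + t) (sym (ℚP.*-zeroʳ x))
qnum-horner x (suc n) = begin
  x * x ^ℕ n + qnum x (suc n)        ≡⟨ cong (λ t → x * x ^ℕ n + t) (qnum-horner x n) ⟩
  x * x ^ℕ n + (1ℚ + x * qnum x n)   ≡⟨ factor x (x ^ℕ n) (qnum x n) ⟩
  1ℚ + x * (x ^ℕ n + qnum x n)       ∎
  where
  open ≡-Reasoning
  factor : ∀ x p r → x * p + (1ℚ + x * r) ≡ 1ℚ + x * (p + r)
  factor = solve-∀ ℚ-ring

module _ {q : ℚ} (q≢0 : q ≢ 0ℚ) where
  open Rescaling q≢0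

  qnum-palindromic : ∀ n → q ^ℕ n * qnum (qinv q) (suc n) ≡ qnum q (suc n)
  qnum-palindromic zero    = ℚP.*-identityˡ (qnum (qinv q) 1)
  qnum-palindromic (suc n) = begin
    q ^ℕ suc n * (qinv q ^ℕ suc n + qnum (qinv q) (suc n))
      ≡⟨ expand q (q ^ℕ n) (qinv q ^ℕ suc n) (qnum (qinv q) (suc n)) ⟩
    q ^ℕ suc n * qinv q ^ℕ suc n + q * (q ^ℕ n * qnum (qinv q) (suc n))
      ≡⟨ cong₂ (λ u v → u + q * v) q^n*q⁻ⁿ≡1 (qnum-palindromic n) ⟩
    1ℚ + q * qnum q (suc n)
      ≡⟨ sym (qnum-horner q (suc n)) ⟩
    qnum q (suc (suc n))
      ∎
    where
    open ≡-Reasoning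
    expand : ∀ x p i r → x * p * (i + r) ≡ x * p * i + x * (p * r)
    expand = solve-∀ ℚ-ring
    q^n*q⁻ⁿ≡1 : q ^ℕ suc n * qinv q ^ℕ suc n ≡ 1ℚ
    q^n*q⁻ⁿ≡1 = trans (cong (q ^ℕ suc n *_) (qinv-^ℕ q (suc n))) (qinv-inverseʳ (^ℕ-≢0 (suc n) q≢0))

  qnum-qinv : ∀ n → qnum (qinv q) (suc n) ≃q^ ℤ.- + n · qnum q (suc n)
  qnum-qinv n = unscale (+ n) (qnum-palindromic n)

  qfact-qinv : ∀ n → qfact (qinv q) n ≃q^ ℤ.- + (n C 2) · qfact q n
  qfact-qinv zero    = rescaled refl
  qfact-qinv (suc n) = rescale-exponent exponent (rescale-* (qnum-qinv n) (qfact-qinv n))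
    where
    exponent : ℤ.- + n ℤ.+ ℤ.- + (n C 2) ≡ ℤ.- + (suc n C 2)
    exponent = trans (sym (ℤP.neg-distrib-+ (+ n) (+ (n C 2)))) (cong (λ t → ℤ.- + t) (sym ([1+n]C2≡n+nC2 n)))

  binomial-quotient-qinv : ∀ k j →
    qfact (qinv q) (k ℕ.+ j) ⊘ (qfact (qinv q) k * qfact (qinv q) j)
      ≃q^ ℤ.- (+ k ℤ.* + j) · qfact q (k ℕ.+ j) ⊘ (qfact q k * qfact q j)
  binomial-quotient-qinv k j =
    rescale-exponent exponent (rescale-⊘ (qfact-qinv (k ℕ.+ j)) (rescale-* (qfact-qinv k) (qfact-qinv j)))
    where
    cancel : ∀ a b p → ℤ.- (a ℤ.+ b ℤ.+ p) ℤ.- (ℤ.- a ℤ.+ ℤ.- b) ≡ ℤ.- p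
    cancel = ℤ-Solver.solve-∀
    exponent : ℤ.- + ((k ℕ.+ j) C 2) ℤ.- (ℤ.- + (k C 2) ℤ.+ ℤ.- + (j C 2)) ≡ ℤ.- (+ k ℤ.* + j)
    exponent = begin
      ℤ.- + ((k ℕ.+ j) C 2) ℤ.- (ℤ.- + (k C 2) ℤ.+ ℤ.- + (j C 2))
        ≡⟨ cong (λ t → ℤ.- + t ℤ.- (ℤ.- + (k C 2) ℤ.+ ℤ.- + (j C 2))) ([m+n]C2≡mC2+nC2+m*n k j) ⟩
      ℤ.- (+ (k C 2) ℤ.+ + (j C 2) ℤ.+ + (k ℕ.* j)) ℤ.- (ℤ.- + (k C 2) ℤ.+ ℤ.- + (j C 2))
        ≡⟨ cong (λ t → ℤ.- (+ (k C 2) ℤ.+ + (j C 2) ℤ.+ t) ℤ.- (ℤ.- + (k C 2) ℤ.+ ℤ.- + (j C 2))) (ℤP.pos-* k j) ⟩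
      ℤ.- (+ (k C 2) ℤ.+ + (j C 2) ℤ.+ + k ℤ.* + j) ℤ.- (ℤ.- + (k C 2) ℤ.+ ℤ.- + (j C 2))
        ≡⟨ cancel (+ (k C 2)) (+ (j C 2)) (+ k ℤ.* + j) ⟩
      ℤ.- (+ k ℤ.* + j)
        ∎
      where open ≡-Reasoning

  qbinom-qinv : ∀ N K → qbinom (qinv q) (+ N) K ≃q^ ℤ.- (K ℤ.* (+ N ℤ.- K)) · qbinom q (+ N) K
  qbinom-qinv N K with K ℤ.<? + 0 | + N ℤ.<? K
  ... | yes _    | _      = rescaled (sym (ℚP.*-zeroʳ (q ^ℤ (ℤ.- (K ℤ.* (+ N ℤ.- K))))))
  ... | no _     | yes _  = rescaled (sym (ℚP.*-zeroʳ (q ^ℤ (ℤ.- (K ℤ.* (+ N ℤ.- K))))))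
  ... | no K≮0   | no N≮K = in-range N K K≮0 N≮K
    where
    k+j-k≡j : ∀ k j → k ℤ.+ j ℤ.- k ≡ j
    k+j-k≡j = ℤ-Solver.solve-∀
    in-range : ∀ N K → ¬ K ℤ.< + 0 → ¬ + N ℤ.< K →
      qfact (qinv q) N ⊘ (qfact (qinv q) ℤ.∣ K ∣ * qfact (qinv q) ℤ.∣ + N ℤ.- K ∣)
        ≃q^ ℤ.- (K ℤ.* (+ N ℤ.- K)) · qfact q N ⊘ (qfact q ℤ.∣ K ∣ * qfact q ℤ.∣ + N ℤ.- K ∣)
    in-range N -[1+ _ ] K≮0 _ = ⊥-elim (K≮0 ℤ.-<+)
    in-range N (+ k) _ N≮k with N ℕ.∸ k | ℕP.m+[n∸m]≡n (ℤP.drop‿+≤+ (ℤP.≮⇒≥ N≮k))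
    ... | j | refl rewrite k+j-k≡j (+ k) (+ j) = binomial-quotient-qinv k j

-- The symmetry of F

weight : ℕ → ℕ → ℤ → ℤ
weight a b k = + a ℤ.* (k ℤ.* k) ℤ.+ (+ 2 ℤ.* + b ℤ.- + 1) ℤ.* choose2 k

weight-duality : ∀ {r s} a b k M N → a ℕ.≤ s → b ℕ.≤ r →
  ℤ.- weight a b k ℤ.+ (ℤ.- M ℤ.+ + r ℤ.* (k ℤ.* k ℤ.- + 1 ℤ.* k)) ℤ.+ (ℤ.- N ℤ.+ + s ℤ.* (k ℤ.* k ℤ.- + 0 ℤ.* k))
    ≡ ℤ.- (M ℤ.+ N) ℤ.+ weight (s ℕ.∸ a) (r ℕ.∸ b ℕ.+ 1) k
weight-duality {r} {s} a b k M N a≤s b≤r = begin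
  ℤ.- weight a b k ℤ.+ (ℤ.- M ℤ.+ + r ℤ.* (k ℤ.* k ℤ.- + 1 ℤ.* k)) ℤ.+ (ℤ.- N ℤ.+ + s ℤ.* (k ℤ.* k ℤ.- + 0 ℤ.* k))
    ≡⟨ cong (λ t → ℤ.- weight a b k ℤ.+ (ℤ.- M ℤ.+ + r ℤ.* t) ℤ.+ (ℤ.- N ℤ.+ + s ℤ.* (k ℤ.* k ℤ.- + 0 ℤ.* k))) k²-k≡2C ⟩
  ℤ.- weight a b k ℤ.+ (ℤ.- M ℤ.+ + r ℤ.* (choose2 k ℤ.* + 2)) ℤ.+ (ℤ.- N ℤ.+ + s ℤ.* (k ℤ.* k ℤ.- + 0 ℤ.* k))
    ≡⟨ regroup (+ a) (+ b) (+ r) (+ s) M N (choose2 k) k ⟩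
  ℤ.- (M ℤ.+ N) ℤ.+ ((+ s ℤ.- + a) ℤ.* (k ℤ.* k) ℤ.+ (+ 2 ℤ.* (+ r ℤ.- + b ℤ.+ + 1) ℤ.- + 1) ℤ.* choose2 k)
    ≡⟨ cong₂ (λ u v → ℤ.- (M ℤ.+ N) ℤ.+ (u ℤ.* (k ℤ.* k) ℤ.+ (+ 2 ℤ.* (v ℤ.+ + 1) ℤ.- + 1) ℤ.* choose2 k))
             (+m-+n≡+[m∸n] a≤s) (+m-+n≡+[m∸n] b≤r) ⟩
  ℤ.- (M ℤ.+ N) ℤ.+ weight (s ℕ.∸ a) (r ℕ.∸ b ℕ.+ 1) k
    ∎
  where
  open ≡-Reasoning
  +m-+n≡+[m∸n] : ∀ {m n} → n ℕ.≤ m → + m ℤ.- + n ≡ + (m ℕ.∸ n)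
  +m-+n≡+[m∸n] {m} {n} n≤m = trans (ℤP.m-n≡m⊖n m n) (ℤP.⊖-≥ n≤m)
  k²-k≡2C : k ℤ.* k ℤ.- + 1 ℤ.* k ≡ choose2 k ℤ.* + 2
  k²-k≡2C = trans (factor k) (sym (choose2*2≡k*[k-1] k))
    where
    factor : ∀ k → k ℤ.* k ℤ.- + 1 ℤ.* k ≡ k ℤ.* (k ℤ.- + 1)
    factor = ℤ-Solver.solve-∀
  regroup : ∀ a b r s M N C k →
    ℤ.- (a ℤ.* (k ℤ.* k) ℤ.+ (+ 2 ℤ.* b ℤ.- + 1) ℤ.* C) ℤ.+ (ℤ.- M ℤ.+ r ℤ.* (C ℤ.* + 2))
      ℤ.+ (ℤ.- N ℤ.+ s ℤ.* (k ℤ.* k ℤ.- + 0 ℤ.* k))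
    ≡ ℤ.- (M ℤ.+ N) ℤ.+ ((s ℤ.- a) ℤ.* (k ℤ.* k) ℤ.+ (+ 2 ℤ.* (r ℤ.- b ℤ.+ + 1) ℤ.- + 1) ℤ.* C)
  regroup = ℤ-Solver.solve-∀

module _ {r s : ℕ} (m : Fin r → ℕ) (n : Fin s → ℕ) where

  mBinomials : ℚ → ℤ → ℚ
  mBinomials q k = prodFin (λ i → qbinom q (+ (m i ℕ.+ m (next i) ℕ.+ 1)) (+ m i ℤ.+ k))

  nBinomials : ℚ → ℤ → ℚ
  nBinomials q k = prodFin (λ j → qbinom q (+ (n j ℕ.+ n (next j))) (+ n j ℤ.+ k))

  summand : ℕ → ℕ → ℚ → ℤ → ℚ
  summand b a q k = (- 1ℚ) ^ℤ k * q ^ℤ weight a b k * mBinomials q k * nBinomials q k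

  mSum : ℤ
  mSum = sumFinℤ (λ i → + (m i ℕ.* (m (next i) ℕ.+ 1)))

  nSum : ℤ
  nSum = sumFinℤ (λ j → + (n j ℕ.* n (next j)))

  module _ {q : ℚ} (q≢0 : q ≢ 0ℚ) where
    open Rescaling q≢0

    mBinomials-qinv : ∀ k → mBinomials (qinv q) k ≃q^ ℤ.- mSum ℤ.+ + r ℤ.* (k ℤ.* k ℤ.- + 1 ℤ.* k) · mBinomials q k
    mBinomials-qinv k = rescale-exponent exponent (rescale-prodFin (λ i → qbinom-qinv q≢0 (m i ℕ.+ m (next i) ℕ.+ 1) (+ m i ℤ.+ k)))
      where
      exponent = trans (cyclic-binomial-exponent (λ i → + m i) (λ i → + (m i ℕ.+ m (next i) ℕ.+ 1)) (+ 1) k (λ _ → refl))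
                       (cong (λ t → ℤ.- t ℤ.+ + r ℤ.* (k ℤ.* k ℤ.- + 1 ℤ.* k))
                             (sumFinℤ-cong (λ i → sym (ℤP.pos-* (m i) (m (next i) ℕ.+ 1)))))

    nBinomials-qinv : ∀ k → nBinomials (qinv q) k ≃q^ ℤ.- nSum ℤ.+ + s ℤ.* (k ℤ.* k ℤ.- + 0 ℤ.* k) · nBinomials q k
    nBinomials-qinv k = rescale-exponent exponent (rescale-prodFin (λ j → qbinom-qinv q≢0 (n j ℕ.+ n (next j)) (+ n j ℤ.+ k)))
      where
      exponent = trans (cyclic-binomial-exponent (λ j → + n j) (λ j → + (n j ℕ.+ n (next j))) (+ 0) k
                                                  (λ j → sym (ℤP.+-identityʳ (+ (n j ℕ.+ n (next j))))))
                       (cong (λ t → ℤ.- t ℤ.+ + s ℤ.* (k ℤ.* k ℤ.- + 0 ℤ.* k))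
                             (sumFinℤ-cong (λ j → trans (cong (+ n j ℤ.*_) (ℤP.+-identityʳ (+ n (next j))))
                                                        (sym (ℤP.pos-* (n j) (n (next j)))))))

    summand-qinv : ∀ a b → a ℕ.≤ s → b ℕ.≤ r → ∀ k →
      summand b a (qinv q) k ≃q^ ℤ.- (mSum ℤ.+ nSum) · summand (r ℕ.∸ b ℕ.+ 1) (s ℕ.∸ a) q k
    summand-qinv a b a≤s b≤r k =
      rescale-common (ℤ.- (mSum ℤ.+ nSum))
        (rescale-* (rescale-* (rescale-*ˡ {x = sign} (qinv-power-rescaled (weight a b k))) (mBinomials-qinv k))
                   (nBinomials-qinv k))
        (rescale-*ʳ {y = nBinomials q k} (rescale-*ʳ {y = mBinomials q k}
          (rescale-*ˡ {x = sign} (power-rescaled (weight (s ℕ.∸ a) (r ℕ.∸ b ℕ.+ 1) k)))))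
        (weight-duality a b k mSum nSum a≤s b≤r)
      where
      sign = (- 1ℚ) ^ℤ k

prefactor : ℚ → ℕ → ℕ → ℕ → ℕ → ℚ
prefactor q m₁ mᵣ n₁ nₛ =
  (qfact q m₁ * qfact q n₁ * qfact q (mᵣ ℕ.+ nₛ ℕ.+ 1)) ⊘ (qfact q (m₁ ℕ.+ mᵣ ℕ.+ 1) * qfact q (n₁ ℕ.+ nₛ))

module _ {q : ℚ} (q≢0 : q ≢ 0ℚ) where
  open Rescaling q≢0

  prefactor-qinv : ∀ m₁ mᵣ n₁ nₛ → prefactor (qinv q) m₁ mᵣ n₁ nₛ
    ≃q^ ℤ.- + (m₁ C 2) ℤ.+ ℤ.- + (n₁ C 2) ℤ.+ ℤ.- + ((mᵣ ℕ.+ nₛ ℕ.+ 1) C 2)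
          ℤ.- (ℤ.- + ((m₁ ℕ.+ mᵣ ℕ.+ 1) C 2) ℤ.+ ℤ.- + ((n₁ ℕ.+ nₛ) C 2))
    · prefactor q m₁ mᵣ n₁ nₛ
  prefactor-qinv m₁ mᵣ n₁ nₛ =
    rescale-⊘ (rescale-* (rescale-* (qfact-qinv q≢0 m₁) (qfact-qinv q≢0 n₁)) (qfact-qinv q≢0 (mᵣ ℕ.+ nₛ ℕ.+ 1)))
              (rescale-* (qfact-qinv q≢0 (m₁ ℕ.+ mᵣ ℕ.+ 1)) (qfact-qinv q≢0 (n₁ ℕ.+ nₛ)))

  F-qinv : ∀ r s .{{_ : ℕ.NonZero r}} .{{_ : ℕ.NonZero s}} (m : Fin r → ℕ) (n : Fin s → ℕ) a b →
           a ℕ.≤ s → b ℕ.≤ r →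
           F r s b m n a (qinv q) ≡ q ^ℤ (ℤ.- Δ r s m n) * F r s (r ℕ.∸ b ℕ.+ 1) m n (s ℕ.∸ a) q
  F-qinv r s m n a b a≤s b≤r = equation (rescale-exponent exponent
    (rescale-* (prefactor-qinv m₁ mᵣ n₁ nₛ)
               (rescale-sumFrom (ℤ.- (+ n₁)) (suc (n₁ ℕ.+ n₁)) (summand-qinv m n q≢0 a b a≤s b≤r))))
    where
    m₁ = m (first r)
    mᵣ = m (lastI r)
    n₁ = n (first s)
    nₛ = n (lastI s)
    M = mSum m n
    N = nSum m n
    Δ≡ : Δ r s m n ≡ + (m₁ C 2) ℤ.+ + (n₁ C 2) ℤ.+ + ((mᵣ ℕ.+ nₛ ℕ.+ 1) C 2)
                     ℤ.- + ((m₁ ℕ.+ mᵣ ℕ.+ 1) C 2) ℤ.- + ((n₁ ℕ.+ nₛ) C 2) ℤ.+ M ℤ.+ N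
    Δ≡ = cong₂ (λ u v → u ℤ.- v ℤ.+ M ℤ.+ N)
               (cong₂ ℤ._-_ (cong₂ ℤ._+_ (cong₂ ℤ._+_ (choose2-pos m₁) (choose2-pos n₁)) (choose2-pos (mᵣ ℕ.+ nₛ ℕ.+ 1)))
                            (choose2-pos (m₁ ℕ.+ mᵣ ℕ.+ 1)))
               (choose2-pos (n₁ ℕ.+ nₛ))
    regroup : ∀ a b c d e M N → ℤ.- a ℤ.+ ℤ.- b ℤ.+ ℤ.- c ℤ.- (ℤ.- d ℤ.+ ℤ.- e) ℤ.+ ℤ.- (M ℤ.+ N)
                                ≡ ℤ.- (a ℤ.+ b ℤ.+ c ℤ.- d ℤ.- e ℤ.+ M ℤ.+ N)
    regroup = ℤ-Solver.solve-∀
    exponent = trans (regroup (+ (m₁ C 2)) (+ (n₁ C 2)) (+ ((mᵣ ℕ.+ nₛ ℕ.+ 1) C 2)) (+ ((m₁ ℕ.+ mᵣ ℕ.+ 1) C 2))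
                              (+ ((n₁ ℕ.+ nₛ) C 2)) M N)
                     (cong ℤ.-_ (sym Δ≡))

-- Boundedness on the unit interval

0≤1 : 0ℚ ≤ 1ℚ
0≤1 = ℚP.nonNegative⁻¹ 1ℚ

0<1 : 0ℚ < 1ℚ
0<1 = ℚP.positive⁻¹ 1ℚ

>0⇒≢0 : ∀ {x} → 0ℚ < x → x ≢ 0ℚ
>0⇒≢0 0<x = ≢-sym (ℚP.<⇒≢ 0<x)

*-mono-≤-nonNeg : ∀ {a b c d} → 0ℚ ≤ a → 0ℚ ≤ c → a ≤ b → c ≤ d → a * c ≤ b * d
*-mono-≤-nonNeg {a} {b} {c} {d} 0≤a 0≤c a≤b c≤d =
  ℚP.≤-trans (ℚP.*-monoʳ-≤-nonNeg c {{ℚ.nonNegative 0≤c}} a≤b)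
             (ℚP.*-monoˡ-≤-nonNeg b {{ℚ.nonNegative (ℚP.≤-trans 0≤a a≤b)}} c≤d)

1≤* : ∀ {a b} → 1ℚ ≤ a → 1ℚ ≤ b → 1ℚ ≤ a * b
1≤* 1≤a 1≤b = *-mono-≤-nonNeg 0≤1 0≤1 1≤a 1≤b

*-nonNeg : ∀ {a b} → 0ℚ ≤ a → 0ℚ ≤ b → 0ℚ ≤ a * b
*-nonNeg {a} {b} 0≤a 0≤b = subst (_≤ a * b) (ℚP.*-zeroˡ 0ℚ) (*-mono-≤-nonNeg ℚP.≤-refl ℚP.≤-refl 0≤a 0≤b)

^ℕ-nonNeg : ∀ {x} n → 0ℚ ≤ x → 0ℚ ≤ x ^ℕ n
^ℕ-nonNeg zero    0≤x = 0≤1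
^ℕ-nonNeg (suc n) 0≤x = *-nonNeg 0≤x (^ℕ-nonNeg n 0≤x)

1≤^ℕ : ∀ {q} n → 1ℚ ≤ q → 1ℚ ≤ q ^ℕ n
1≤^ℕ zero    1≤q = ℚP.≤-refl
1≤^ℕ (suc n) 1≤q = 1≤* 1≤q (1≤^ℕ n 1≤q)

qinv-pos : ∀ {y} → 0ℚ < y → 0ℚ < qinv y
qinv-pos {y} 0<y = ℚP.≰⇒> λ qinv[y]≤0 → ℚP.<-irrefl refl (ℚP.<-≤-trans 0<1 (begin
  1ℚ           ≡⟨ sym (qinv-inverseˡ (>0⇒≢0 0<y)) ⟩
  qinv y * y   ≤⟨ ℚP.*-monoʳ-≤-nonNeg y {{ℚ.nonNegative (ℚP.<⇒≤ 0<y)}} qinv[y]≤0 ⟩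
  0ℚ * y       ≡⟨ ℚP.*-zeroˡ y ⟩
  0ℚ           ∎))
  where open ℚP.≤-Reasoning

qinv-≤1 : ∀ {y} → 1ℚ ≤ y → qinv y ≤ 1ℚ
qinv-≤1 {y} 1≤y = begin
  qinv y            ≡⟨ sym (ℚP.*-identityʳ (qinv y)) ⟩
  qinv y * 1ℚ       ≤⟨ ℚP.*-monoˡ-≤-nonNeg (qinv y) {{ℚ.nonNegative (ℚP.<⇒≤ (qinv-pos 0<y))}} 1≤y ⟩
  qinv y * y        ≡⟨ qinv-inverseˡ (>0⇒≢0 0<y) ⟩
  1ℚ                ∎
  where
  open ℚP.≤-Reasoning
  0<y = ℚP.<-≤-trans 0<1 1≤y

∣qinv∣≤1 : ∀ {y} → 1ℚ ≤ y → ∣ qinv y ∣ ≤ 1ℚ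
∣qinv∣≤1 {y} 1≤y = subst (_≤ 1ℚ) (sym (ℚP.0≤p⇒∣p∣≡p (ℚP.<⇒≤ (qinv-pos (ℚP.<-≤-trans 0<1 1≤y)))))
                         (qinv-≤1 1≤y)

∣x∣≤∣q*x∣ : ∀ q x → 1ℚ ≤ q → ∣ x ∣ ≤ ∣ q * x ∣
∣x∣≤∣q*x∣ q x 1≤q = begin
  ∣ x ∣               ≡⟨ sym (ℚP.*-identityˡ ∣ x ∣) ⟩
  1ℚ * ∣ x ∣          ≤⟨ ℚP.*-monoʳ-≤-nonNeg ∣ x ∣ {{ℚP.∣-∣-nonNeg x}} 1≤q ⟩
  q * ∣ x ∣           ≡⟨ cong (_* ∣ x ∣) (sym (ℚP.0≤p⇒∣p∣≡p (ℚP.≤-trans 0≤1 1≤q))) ⟩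
  ∣ q ∣ * ∣ x ∣       ≡⟨ sym (ℚP.∣p*q∣≡∣p∣*∣q∣ q x) ⟩
  ∣ q * x ∣           ∎
  where open ℚP.≤-Reasoning

BoundedOnUnitInterval : (ℚ → ℚ) → Set
BoundedOnUnitInterval f = Σ ℚ λ B → ∀ x → 0ℚ ≤ x → x ≤ 1ℚ → ∣ f x ∣ ≤ B

bounded-const : ∀ c → BoundedOnUnitInterval (λ _ → c)
bounded-const c = ∣ c ∣ , λ _ _ _ → ℚP.≤-refl

bounded-id : BoundedOnUnitInterval (λ x → x)
bounded-id = 1ℚ , λ x 0≤x x≤1 → subst (_≤ 1ℚ) (sym (ℚP.0≤p⇒∣p∣≡p 0≤x)) x≤1

bounded-+ : ∀ {f g : ℚ → ℚ} → BoundedOnUnitInterval f → BoundedOnUnitInterval g → BoundedOnUnitInterval (λ x → f x + g x)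
bounded-+ {f} {g} (B , ∣f∣≤B) (D , ∣g∣≤D) = B + D , λ x 0≤x x≤1 →
  ℚP.≤-trans (ℚP.∣p+q∣≤∣p∣+∣q∣ (f x) (g x)) (ℚP.+-mono-≤ (∣f∣≤B x 0≤x x≤1) (∣g∣≤D x 0≤x x≤1))

bounded-* : ∀ {f g : ℚ → ℚ} → BoundedOnUnitInterval f → BoundedOnUnitInterval g → BoundedOnUnitInterval (λ x → f x * g x)
bounded-* {f} {g} (B , ∣f∣≤B) (D , ∣g∣≤D) = B * D , λ x 0≤x x≤1 →
  subst (_≤ B * D) (sym (ℚP.∣p*q∣≡∣p∣*∣q∣ (f x) (g x)))
        (*-mono-≤-nonNeg (ℚP.0≤∣p∣ (f x)) (ℚP.0≤∣p∣ (g x)) (∣f∣≤B x 0≤x x≤1) (∣g∣≤D x 0≤x x≤1))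

bounded-⊘ : ∀ {f g : ℚ → ℚ} → BoundedOnUnitInterval f → (∀ x → 0ℚ ≤ x → x ≤ 1ℚ → 1ℚ ≤ g x) →
            BoundedOnUnitInterval (λ x → f x ⊘ g x)
bounded-⊘ {f} {g} (B , ∣f∣≤B) 1≤g = B , λ x 0≤x x≤1 → begin
  ∣ f x ⊘ g x ∣               ≡⟨ cong ∣_∣ (⊘≡*qinv (f x) (g x)) ⟩
  ∣ f x * qinv (g x) ∣        ≡⟨ ℚP.∣p*q∣≡∣p∣*∣q∣ (f x) (qinv (g x)) ⟩
  ∣ f x ∣ * ∣ qinv (g x) ∣    ≤⟨ *-mono-≤-nonNeg (ℚP.0≤∣p∣ (f x)) (ℚP.0≤∣p∣ (qinv (g x)))
                                                 (∣f∣≤B x 0≤x x≤1) (∣qinv∣≤1 (1≤g x 0≤x x≤1)) ⟩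
  B * 1ℚ                      ≡⟨ ℚP.*-identityʳ B ⟩
  B                           ∎
  where open ℚP.≤-Reasoning

bounded-prodFin : ∀ {n} {f : Fin n → ℚ → ℚ} → (∀ i → BoundedOnUnitInterval (f i)) →
                  BoundedOnUnitInterval (λ x → prodFin (λ i → f i x))
bounded-prodFin {zero}  bounded = bounded-const 1ℚ
bounded-prodFin {suc n} bounded = bounded-* (bounded zero) (bounded-prodFin (λ i → bounded (suc i)))

bounded-sumFrom : ∀ lo len {f : ℚ → ℤ → ℚ} → (∀ k → BoundedOnUnitInterval (λ x → f x k)) →
                  BoundedOnUnitInterval (λ x → sumFrom lo len (f x))
bounded-sumFrom lo zero      bounded = bounded-const 0ℚ
bounded-sumFrom lo (suc len) bounded = bounded-+ (bounded lo) (bounded-sumFrom (ℤ.suc lo) len bounded)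

qnum-nonNeg : ∀ {x} n → 0ℚ ≤ x → 0ℚ ≤ qnum x n
qnum-nonNeg zero    0≤x = ℚP.≤-refl
qnum-nonNeg (suc n) 0≤x = ℚP.+-mono-≤ (^ℕ-nonNeg n 0≤x) (qnum-nonNeg n 0≤x)

1≤qnum : ∀ {x} n → 0ℚ ≤ x → 1ℚ ≤ qnum x (suc n)
1≤qnum {x} n 0≤x = subst (1ℚ ≤_) (sym (qnum-horner x n))
  (subst (_≤ 1ℚ + x * qnum x n) (ℚP.+-identityʳ 1ℚ) (ℚP.+-monoʳ-≤ 1ℚ (*-nonNeg 0≤x (qnum-nonNeg n 0≤x))))

1≤qfact : ∀ {x} n → 0ℚ ≤ x → 1ℚ ≤ qfact x n
1≤qfact zero    0≤x = ℚP.≤-refl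
1≤qfact (suc n) 0≤x = 1≤* (1≤qnum n 0≤x) (1≤qfact n 0≤x)

bounded-^ℕ : ∀ n → BoundedOnUnitInterval (λ x → x ^ℕ n)
bounded-^ℕ zero    = bounded-const 1ℚ
bounded-^ℕ (suc n) = bounded-* bounded-id (bounded-^ℕ n)

bounded-qnum : ∀ n → BoundedOnUnitInterval (λ x → qnum x n)
bounded-qnum zero    = bounded-const 0ℚ
bounded-qnum (suc n) = bounded-+ (bounded-^ℕ n) (bounded-qnum n)

bounded-qfact : ∀ n → BoundedOnUnitInterval (λ x → qfact x n)
bounded-qfact zero    = bounded-const 1ℚ
bounded-qfact (suc n) = bounded-* (bounded-qnum (suc n)) (bounded-qfact n)

bounded-qbinom : ∀ N K → BoundedOnUnitInterval (λ x → qbinom x (+ N) K)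
bounded-qbinom N K with K ℤ.<? + 0 | + N ℤ.<? K
... | yes _ | _     = bounded-const 0ℚ
... | no _  | yes _ = bounded-const 0ℚ
... | no _  | no _  = bounded-⊘ (bounded-qfact N)
                                (λ x 0≤x _ → 1≤* (1≤qfact ℤ.∣ K ∣ 0≤x) (1≤qfact ℤ.∣ + N ℤ.- K ∣ 0≤x))

weight-nonNeg : ∀ a b k →
  weight a (suc b) k ≡ + (a ℕ.* (ℤ.∣ k ∣ ℕ.* ℤ.∣ k ∣) ℕ.+ suc (2 ℕ.* b) ℕ.* ℤ.∣ choose2 k ∣)
weight-nonNeg a b k = begin
  + a ℤ.* (k ℤ.* k) ℤ.+ (+ 2 ℤ.* + suc b ℤ.- + 1) ℤ.* choose2 k
    ≡⟨ cong₂ (λ u v → + a ℤ.* u ℤ.+ v) (square k) (cong₂ ℤ._*_ 2[1+b]-1≡1+2b (choose2≡+∣choose2∣ k)) ⟩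
  + a ℤ.* + (ℤ.∣ k ∣ ℕ.* ℤ.∣ k ∣) ℤ.+ + suc (2 ℕ.* b) ℤ.* + ℤ.∣ choose2 k ∣
    ≡⟨ cong₂ ℤ._+_ (sym (ℤP.pos-* a _)) (sym (ℤP.pos-* (suc (2 ℕ.* b)) _)) ⟩
  + (a ℕ.* (ℤ.∣ k ∣ ℕ.* ℤ.∣ k ∣) ℕ.+ suc (2 ℕ.* b) ℕ.* ℤ.∣ choose2 k ∣)
    ∎
  where
  open ≡-Reasoning
  square : ∀ k → k ℤ.* k ≡ + (ℤ.∣ k ∣ ℕ.* ℤ.∣ k ∣)
  square (+ n)    = sym (ℤP.pos-* n n)
  square -[1+ n ] = refl
  2[1+b]-1≡1+2b : + 2 ℤ.* + suc b ℤ.- + 1 ≡ + suc (2 ℕ.* b)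
  2[1+b]-1≡1+2b = cong +_ (ℕP.+-suc b (b ℕ.+ 0))

bounded-summand : ∀ {r s} (m : Fin r → ℕ) (n : Fin s → ℕ) a b k →
                  BoundedOnUnitInterval (λ x → summand m n (suc b) a x k)
bounded-summand m n a b k =
  bounded-* (bounded-* (bounded-* (bounded-const ((- 1ℚ) ^ℤ k)) power)
                       (bounded-prodFin (λ i → bounded-qbinom (m i ℕ.+ m (next i) ℕ.+ 1) (+ m i ℤ.+ k))))
            (bounded-prodFin (λ j → bounded-qbinom (n j ℕ.+ n (next j)) (+ n j ℤ.+ k)))
  where
  power : BoundedOnUnitInterval (λ x → x ^ℤ weight a (suc b) k)
  power = subst (λ e → BoundedOnUnitInterval (λ x → x ^ℤ e)) (sym (weight-nonNeg a b k))
                (bounded-^ℕ (a ℕ.* (ℤ.∣ k ∣ ℕ.* ℤ.∣ k ∣) ℕ.+ suc (2 ℕ.* b) ℕ.* ℤ.∣ choose2 k ∣))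

bounded-F : ∀ r s .{{_ : ℕ.NonZero r}} .{{_ : ℕ.NonZero s}} (m : Fin r → ℕ) (n : Fin s → ℕ) a b →
            BoundedOnUnitInterval (F r s (suc b) m n a)
bounded-F r s m n a b =
  bounded-* (bounded-⊘ (bounded-* (bounded-* (bounded-qfact m₁) (bounded-qfact n₁)) (bounded-qfact (mᵣ ℕ.+ nₛ ℕ.+ 1)))
                       (λ x 0≤x _ → 1≤* (1≤qfact (m₁ ℕ.+ mᵣ ℕ.+ 1) 0≤x) (1≤qfact (n₁ ℕ.+ nₛ) 0≤x)))
            (bounded-sumFrom (ℤ.- (+ n₁)) (suc (n₁ ℕ.+ n₁)) (bounded-summand m n a b))
  where
  m₁ = m (first r)
  mᵣ = m (lastI r)
  n₁ = n (first s)
  nₛ = n (lastI s)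

-- Polynomials of bounded growth

evalPoly-zero : ∀ cs → (∀ i → coeff cs i ≡ 0ℚ) → ∀ q → evalPoly cs q ≡ 0ℚ
evalPoly-zero []       _    q = refl
evalPoly-zero (c ∷ cs) cs≡0 q = begin
  c + q * evalPoly cs q   ≡⟨ cong₂ (λ u v → u + q * v) (cs≡0 0) (evalPoly-zero cs (λ i → cs≡0 (suc i)) q) ⟩
  0ℚ + q * 0ℚ             ≡⟨ trans (ℚP.+-identityˡ (q * 0ℚ)) (ℚP.*-zeroʳ q) ⟩
  0ℚ                      ∎
  where open ≡-Reasoning

evalPoly-const : ∀ cs → (∀ i → coeff cs (suc i) ≡ 0ℚ) → ∀ q → evalPoly cs q ≡ coeff cs 0
evalPoly-const []       _    q = refl
evalPoly-const (c ∷ cs) cs≡0 q = begin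
  c + q * evalPoly cs q   ≡⟨ cong (λ t → c + q * t) (evalPoly-zero cs cs≡0 q) ⟩
  c + q * 0ℚ              ≡⟨ trans (cong (λ t → c + t) (ℚP.*-zeroʳ q)) (ℚP.+-identityʳ c) ⟩
  c                       ∎
  where open ≡-Reasoning

archimedean : ∀ {d B} → (∀ q → 1ℚ < q → ∣ q * d ∣ ≤ B) → d ≡ 0ℚ
archimedean {d} {B} bounded with toSum (d ℚP.≟ 0ℚ)
... | inj₁ d≡0 = d≡0
... | inj₂ d≢0 = ⊥-elim (ℚP.<-irrefl refl (ℚP.<-≤-trans B<q∣d∣ (subst (_≤ B) ∣qd∣≡q∣d∣ (bounded q 1<q))))
  where
  2ℚ = 1ℚ + 1ℚ
  1<2 : 1ℚ < 2ℚ
  1<2 = ℚ.*<* (ℤ.+<+ (ℕ.s≤s (ℕ.s≤s ℕ.z≤n)))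
  a = ∣ d ∣
  0<a : 0ℚ < a
  0<a = ℚP.≰⇒> λ a≤0 → d≢0 (ℚP.∣p∣≡0⇒p≡0 d (ℚP.≤-antisym a≤0 (ℚP.0≤∣p∣ d)))
  0≤B : 0ℚ ≤ B
  0≤B = ℚP.≤-trans (ℚP.0≤∣p∣ (2ℚ * d)) (bounded 2ℚ 1<2)
  q = 2ℚ + B * qinv a
  1<q : 1ℚ < q
  1<q = ℚP.<-≤-trans 1<2 (subst (_≤ q) (ℚP.+-identityʳ 2ℚ)
                                  (ℚP.+-monoʳ-≤ 2ℚ (*-nonNeg 0≤B (ℚP.<⇒≤ (qinv-pos 0<a)))))
  ∣qd∣≡q∣d∣ : ∣ q * d ∣ ≡ q * a
  ∣qd∣≡q∣d∣ = trans (ℚP.∣p*q∣≡∣p∣*∣q∣ q d) (cong (_* a) (ℚP.0≤p⇒∣p∣≡p (ℚP.<⇒≤ (ℚP.<-trans 0<1 1<q))))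
  B<q∣d∣ : B < q * a
  B<q∣d∣ = begin-strict
    B                          ≡⟨ sym (ℚP.+-identityˡ B) ⟩
    0ℚ + B                     <⟨ ℚP.+-monoˡ-< B (ℚP.+-mono-< 0<a 0<a) ⟩
    a + a + B                  ≡⟨ cong (λ t → a + a + t) (sym (ℚP.*-identityʳ B)) ⟩
    a + a + B * 1ℚ             ≡⟨ cong (λ t → a + a + B * t) (sym (qinv-inverseˡ (>0⇒≢0 0<a))) ⟩
    a + a + B * (qinv a * a)   ≡⟨ distribute a B (qinv a) ⟩
    q * a                      ∎
    where
    open ℚP.≤-Reasoning
    distribute : ∀ a c i → a + a + c * (i * a) ≡ (1ℚ + 1ℚ + c * i) * a
    distribute = solve-∀ ℚ-ring

peel-constant : ∀ c B D (p : ℚ → ℚ) → (∀ q → 1ℚ < q → ∣ c + q * p q ∣ ≤ B * q ^ℕ D) →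
                ∀ q → 1ℚ < q → ∣ q * p q ∣ ≤ (B + ∣ c ∣) * q ^ℕ D
peel-constant c B D p bounded q 1<q = begin
  ∣ q * p q ∣                    ≡⟨ cong ∣_∣ (sym (add-sub c (q * p q))) ⟩
  ∣ c + q * p q - c ∣            ≤⟨ ℚP.∣p-q∣≤∣p∣+∣q∣ (c + q * p q) c ⟩
  ∣ c + q * p q ∣ + ∣ c ∣         ≤⟨ ℚP.+-mono-≤ (bounded q 1<q) ∣c∣≤∣c∣*q^D ⟩
  B * q ^ℕ D + ∣ c ∣ * q ^ℕ D    ≡⟨ sym (ℚP.*-distribʳ-+ (q ^ℕ D) B ∣ c ∣) ⟩
  (B + ∣ c ∣) * q ^ℕ D           ∎
  where
  open ℚP.≤-Reasoning
  add-sub : ∀ c x → c + x - c ≡ x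
  add-sub = solve-∀ ℚ-ring
  ∣c∣≤∣c∣*q^D : ∣ c ∣ ≤ ∣ c ∣ * q ^ℕ D
  ∣c∣≤∣c∣*q^D = subst (_≤ ∣ c ∣ * q ^ℕ D) (ℚP.*-identityʳ ∣ c ∣)
                      (ℚP.*-monoˡ-≤-nonNeg ∣ c ∣ {{ℚP.∣-∣-nonNeg c}} (1≤^ℕ D (ℚP.<⇒≤ 1<q)))

-- Writing p = c + q p′, a bound B qᴰ⁺¹ on p gives the bound (B + ∣c∣) qᴰ on p′; for D = 0 it bounds
-- q p′, which forces p′ to be constant (induction) and then zero (archimedean).
coeff-vanishes-above : ∀ cs D B → (∀ q → 1ℚ < q → ∣ evalPoly cs q ∣ ≤ B * q ^ℕ D) →
                       ∀ i → D ℕ.< i → coeff cs i ≡ 0ℚ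
coeff-vanishes-above []       D       B bounded i       D<i = refl
coeff-vanishes-above (c ∷ cs) zero    B bounded (suc i) D<i = tail-vanishes i
  where
  B′ = B + ∣ c ∣
  tail-peeled : ∀ q → 1ℚ < q → ∣ q * evalPoly cs q ∣ ≤ B′ * 1ℚ
  tail-peeled = peel-constant c B 0 (evalPoly cs) bounded
  tail-bounded : ∀ q → 1ℚ < q → ∣ evalPoly cs q ∣ ≤ B′ * q ^ℕ 0
  tail-bounded q 1<q = ℚP.≤-trans (∣x∣≤∣q*x∣ q (evalPoly cs q) (ℚP.<⇒≤ 1<q)) (tail-peeled q 1<q)
  higher : ∀ j → coeff cs (suc j) ≡ 0ℚ
  higher j = coeff-vanishes-above cs zero B′ tail-bounded (suc j) (ℕ.s≤s ℕ.z≤n)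
  constant : coeff cs 0 ≡ 0ℚ
  constant = archimedean λ q 1<q →
    subst (λ t → ∣ q * t ∣ ≤ B′) (evalPoly-const cs higher q)
          (subst (∣ q * evalPoly cs q ∣ ≤_) (ℚP.*-identityʳ B′) (tail-peeled q 1<q))
  tail-vanishes : ∀ i → coeff cs i ≡ 0ℚ
  tail-vanishes zero    = constant
  tail-vanishes (suc j) = higher j
coeff-vanishes-above (c ∷ cs) (suc D) B bounded (suc i) (ℕ.s≤s D<i) =
  coeff-vanishes-above cs D (B + ∣ c ∣) tail-bounded i D<i
  where
  tail-bounded : ∀ q → 1ℚ < q → ∣ evalPoly cs q ∣ ≤ (B + ∣ c ∣) * q ^ℕ D
  tail-bounded q 1<q = ℚP.*-cancelˡ-≤-pos q {{ℚ.positive 0<q}} (begin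
    q * ∣ evalPoly cs q ∣               ≡⟨ cong (_* ∣ evalPoly cs q ∣) (sym (ℚP.0≤p⇒∣p∣≡p (ℚP.<⇒≤ 0<q))) ⟩
    ∣ q ∣ * ∣ evalPoly cs q ∣           ≡⟨ sym (ℚP.∣p*q∣≡∣p∣*∣q∣ q (evalPoly cs q)) ⟩
    ∣ q * evalPoly cs q ∣               ≤⟨ peel-constant c B (suc D) (evalPoly cs) bounded q 1<q ⟩
    (B + ∣ c ∣) * (q * q ^ℕ D)          ≡⟨ x∙yz≈y∙xz (B + ∣ c ∣) q (q ^ℕ D) ⟩
    q * ((B + ∣ c ∣) * q ^ℕ D)          ∎)
    where
    open ℚP.≤-Reasoning
    0<q = ℚP.<-trans 0<1 1<q

evalPoly-shift : ∀ t cs q → evalPoly (replicate t 0ℚ ++ cs) q ≡ q ^ℕ t * evalPoly cs q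
evalPoly-shift zero    cs q = sym (ℚP.*-identityˡ (evalPoly cs q))
evalPoly-shift (suc t) cs q = begin
  0ℚ + q * evalPoly (replicate t 0ℚ ++ cs) q    ≡⟨ cong (λ u → 0ℚ + q * u) (evalPoly-shift t cs q) ⟩
  0ℚ + q * (q ^ℕ t * evalPoly cs q)             ≡⟨ trans (ℚP.+-identityˡ _) (sym (ℚP.*-assoc q (q ^ℕ t) (evalPoly cs q))) ⟩
  q * q ^ℕ t * evalPoly cs q                    ∎
  where open ≡-Reasoning

coeff-shift : ∀ t cs i → coeff (replicate t 0ℚ ++ cs) (t ℕ.+ i) ≡ coeff cs i
coeff-shift zero    cs i = refl
coeff-shift (suc t) cs i = coeff-shift t cs i

coeff-vanishes-above-ℤ : ∀ cs B e → (∀ q → 1ℚ < q → ∣ evalPoly cs q ∣ ≤ B * ∣ q ^ℤ e ∣) →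
                         ∀ i → e ℤ.< + i → coeff cs i ≡ 0ℚ
coeff-vanishes-above-ℤ cs B e bounded i e<i =
  trans (sym (coeff-shift t cs i)) (coeff-vanishes-above (replicate t 0ℚ ++ cs) D B shifted-bounded (t ℕ.+ i) D<t+i)
  where
  t = ℤ.∣ e ∣
  ∣e∣+e-nonNeg : ∀ e → Σ ℕ λ D → + ℤ.∣ e ∣ ℤ.+ e ≡ + D
  ∣e∣+e-nonNeg (+ n)    = n ℕ.+ n , refl
  ∣e∣+e-nonNeg -[1+ n ] = 0 , ℤP.n⊖n≡0 (suc n)
  D = proj₁ (∣e∣+e-nonNeg e)
  t+e≡D = proj₂ (∣e∣+e-nonNeg e)
  D<t+i : D ℕ.< t ℕ.+ i
  D<t+i = ℤP.drop‿+<+ (subst (ℤ._< + (t ℕ.+ i)) t+e≡D (ℤP.+-monoʳ-< (+ t) e<i))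
  shifted-bounded : ∀ q → 1ℚ < q → ∣ evalPoly (replicate t 0ℚ ++ cs) q ∣ ≤ B * q ^ℕ D
  shifted-bounded q 1<q = begin
    ∣ evalPoly (replicate t 0ℚ ++ cs) q ∣    ≡⟨ cong ∣_∣ (evalPoly-shift t cs q) ⟩
    ∣ q ^ℕ t * evalPoly cs q ∣               ≡⟨ ℚP.∣p*q∣≡∣p∣*∣q∣ (q ^ℕ t) (evalPoly cs q) ⟩
    ∣ q ^ℕ t ∣ * ∣ evalPoly cs q ∣           ≤⟨ ℚP.*-monoˡ-≤-nonNeg ∣ q ^ℕ t ∣ {{ℚP.∣-∣-nonNeg (q ^ℕ t)}} (bounded q 1<q) ⟩
    ∣ q ^ℕ t ∣ * (B * ∣ q ^ℤ e ∣)            ≡⟨ x∙yz≈y∙xz ∣ q ^ℕ t ∣ B ∣ q ^ℤ e ∣ ⟩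
    B * (∣ q ^ℕ t ∣ * ∣ q ^ℤ e ∣)            ≡⟨ cong (B *_) (sym (ℚP.∣p*q∣≡∣p∣*∣q∣ (q ^ℕ t) (q ^ℤ e))) ⟩
    B * ∣ q ^ℤ (+ t) * q ^ℤ e ∣              ≡⟨ cong (λ u → B * ∣ u ∣) (sym (^ℤ-homo-+ q≢0 (+ t) e)) ⟩
    B * ∣ q ^ℤ (+ t ℤ.+ e) ∣                 ≡⟨ cong (λ u → B * ∣ q ^ℤ u ∣) t+e≡D ⟩
    B * ∣ q ^ℕ D ∣                           ≡⟨ cong (B *_) (ℚP.0≤p⇒∣p∣≡p (^ℕ-nonNeg D 0≤q)) ⟩
    B * q ^ℕ D                               ∎
    where
    open ℚP.≤-Reasoning
    0≤q = ℚP.≤-trans 0≤1 (ℚP.<⇒≤ 1<q)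
    q≢0 = >0⇒≢0 (ℚP.<-trans 0<1 1<q)

F-dual : ∀ {q} → q ≢ 0ℚ → ∀ r s .{{_ : ℕ.NonZero r}} .{{_ : ℕ.NonZero s}} (m : Fin r → ℕ) (n : Fin s → ℕ) a b →
         a ℕ.≤ s → b ℕ.≤ r →
         F r s (r ℕ.∸ b ℕ.+ 1) m n (s ℕ.∸ a) q ≡ q ^ℤ Δ r s m n * F r s b m n a (qinv q)
F-dual q≢0 r s m n a b a≤s b≤r =
  equation (rescale-exponent (ℤP.neg-involutive (Δ r s m n)) (unscale (ℤ.- Δ r s m n) (sym (F-qinv q≢0 r s m n a b a≤s b≤r))))
  where open Rescaling q≢0

F-growth : ∀ r s .{{_ : ℕ.NonZero r}} .{{_ : ℕ.NonZero s}} (m : Fin r → ℕ) (n : Fin s → ℕ) a b →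
           a ℕ.≤ s → suc b ℕ.≤ r →
           Σ ℚ λ B → ∀ q → 1ℚ < q → ∣ F r s (r ℕ.∸ suc b ℕ.+ 1) m n (s ℕ.∸ a) q ∣ ≤ B * ∣ q ^ℤ Δ r s m n ∣
F-growth r s m n a b a≤s b≤r = B , growth
  where
  B = proj₁ (bounded-F r s m n a b)
  Δ′ = Δ r s m n
  F′ = F r s (r ℕ.∸ suc b ℕ.+ 1) m n (s ℕ.∸ a)
  F₀ = F r s (suc b) m n a
  growth : ∀ q → 1ℚ < q → ∣ F′ q ∣ ≤ B * ∣ q ^ℤ Δ′ ∣
  growth q 1<q = begin
    ∣ F′ q ∣                      ≡⟨ cong ∣_∣ (F-dual q≢0 r s m n a (suc b) a≤s b≤r) ⟩
    ∣ q ^ℤ Δ′ * F₀ (qinv q) ∣      ≡⟨ ℚP.∣p*q∣≡∣p∣*∣q∣ (q ^ℤ Δ′) (F₀ (qinv q)) ⟩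
    ∣ q ^ℤ Δ′ ∣ * ∣ F₀ (qinv q) ∣  ≤⟨ ℚP.*-monoˡ-≤-nonNeg ∣ q ^ℤ Δ′ ∣ {{ℚP.∣-∣-nonNeg (q ^ℤ Δ′)}}
                                       (proj₂ (bounded-F r s m n a b) (qinv q) 0≤qinv[q] (qinv-≤1 1≤q)) ⟩
    ∣ q ^ℤ Δ′ ∣ * B               ≡⟨ ℚP.*-comm ∣ q ^ℤ Δ′ ∣ B ⟩
    B * ∣ q ^ℤ Δ′ ∣               ∎
    where
    open ℚP.≤-Reasoning
    1≤q = ℚP.<⇒≤ 1<q
    0<q = ℚP.<-trans 0<1 1<q
    q≢0 = >0⇒≢0 0<q
    0≤qinv[q] = ℚP.<⇒≤ (qinv-pos 0<q)

1<q⇒admissible : ∀ {q} → 1ℚ < q → Admissible q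
1<q⇒admissible {q} 1<q = >0⇒≢0 0<q , ≢-sym (ℚP.<⇒≢ 1<q) , ≢-sym (ℚP.<⇒≢ (ℚP.<-trans (ℚP.negative⁻¹ (- 1ℚ)) 0<q))
  where 0<q = ℚP.<-trans 0<1 1<q

lemma3p1 : (r s : ℕ) → .{{_ : ℕ.NonZero r}} → .{{_ : ℕ.NonZero s}} →
           (m : Fin r → ℕ) → (n : Fin s → ℕ) → (a b : ℕ) →
           a ℕ.≤ s → 1 ℕ.≤ b → b ℕ.≤ r →
           ((q : ℚ) → Admissible q →
             F r s b m n a (qinv q)
               ≡ (q ^ℤ (ℤ.- Δ r s m n)) * F r s (r ℕ.∸ b ℕ.+ 1) m n (s ℕ.∸ a) q)
           × ((cs : List ℚ) →
              ((q : ℚ) → Admissible q → F r s (r ℕ.∸ b ℕ.+ 1) m n (s ℕ.∸ a) q ≡ evalPoly cs q) →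
              (i : ℕ) → Δ r s m n ℤ.< + i → coeff cs i ≡ 0ℚ)
lemma3p1 r s m n a zero    a≤s ()  b≤r
lemma3p1 r s m n a (suc b) a≤s 1≤b b≤r = symmetry , degree-bound
  where
  symmetry : ∀ q → Admissible q →
             F r s (suc b) m n a (qinv q) ≡ q ^ℤ (ℤ.- Δ r s m n) * F r s (r ℕ.∸ suc b ℕ.+ 1) m n (s ℕ.∸ a) q
  symmetry q (q≢0 , _) = F-qinv q≢0 r s m n a (suc b) a≤s b≤r
  degree-bound : ∀ cs → (∀ q → Admissible q → F r s (r ℕ.∸ suc b ℕ.+ 1) m n (s ℕ.∸ a) q ≡ evalPoly cs q) →
                 ∀ i → Δ r s m n ℤ.< + i → coeff cs i ≡ 0ℚ
  degree-bound cs F≡cs =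
    let B , growth = F-growth r s m n a b a≤s b≤r in
    coeff-vanishes-above-ℤ cs B (Δ r s m n) λ q 1<q →
      subst (λ t → ∣ t ∣ ≤ B * ∣ q ^ℤ Δ r s m n ∣) (F≡cs q (1<q⇒admissible 1<q)) (growth q 1<q)
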